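{- Let $G$ be a graph, $k\ge0$ an integer, and $H\in\mathcal{S}_2^k(G)$. Then $\alpha(H)=\alpha(G)+k$.
   Context: All graphs are finite, simple, undirected; $\alpha(G)$ is the maximum cardinality of a stable set of $G$. Vertex stretching with $p=2$: given $G$, $v\in V(G)$ and nonempty proper subsets $A_1,A_2$ of $\Gamma_G(v)$ with $A_1\cup A_2=\Gamma_G(v)$, the $2$-stretching of $v$ replaces $v$ by new vertices $v_0,v_1,v_2$, joins $v_1,v_2$ to $v_0$, and joins $v_\ell$ to all vertices of $A_\ell$ ($\ell=1,2$). $\mathcal{S}_2(G)$ is the set of graphs obtained from $G$ by $2$-stretching one vertex; $\mathcal{S}_2^0(G)=\{G\}$ and $\mathcal{S}_2^k(G)=\bigcup_{G'\in\mathcal{S}_2^{k-1}(G)}\mathcal{S}_2(G')$. -}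

module Defs where

open import Data.Nat using (ℕ; zero; suc; _+_; _≤_)
open import Data.Bool using (Bool; true; false; _∨_; if_then_else_)
open import Data.Bool.Properties using (∨-comm)
open import Data.Fin using (Fin; zero; suc; _≟_)
open import Data.Fin.Subset using (Subset; _∈_; _∉_; ∣_∣)
open import Data.Vec using (lookup)
open import Data.Product using (Σ; ∃; _×_; _,_)
open import Data.Sum using (_⊎_)
open import Relation.Nullary.Decidable using (⌊_⌋)
open import Relation.Binary.PropositionalEquality using (_≡_; refl; cong₂)

record Graph (n : ℕ) : Set where
  field
    adj   : Fin n → Fin n → Bool
    sym   : ∀ i j → adj i j ≡ adj j i
    irref : ∀ i → adj i i ≡ false
open Graph public

_∈Γ[_]_ : ∀ {n} → Fin n → Graph n → Fin n → Set
u ∈Γ[ G ] v = adj G v u ≡ true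

Stable : ∀ {n} → Graph n → Subset n → Set
Stable G S = ∀ i j → i ∈ S → j ∈ S → adj G i j ≡ false

IsAlpha : ∀ {n} → Graph n → ℕ → Set
IsAlpha {n} G a =
  (Σ (Subset n) λ S → Stable G S × ∣ S ∣ ≡ a) ×
  (∀ (S : Subset n) → Stable G S → ∣ S ∣ ≤ a)

record StretchData {n} (G : Graph n) (v : Fin n) (A₁ A₂ : Subset n) : Set where
  field
    sub₁     : ∀ u → u ∈ A₁ → u ∈Γ[ G ] v
    sub₂     : ∀ u → u ∈ A₂ → u ∈Γ[ G ] v
    nonempty₁ : ∃ λ u → u ∈ A₁
    nonempty₂ : ∃ λ u → u ∈ A₂
    proper₁  : ∃ λ u → u ∈Γ[ G ] v × u ∉ A₁
    proper₂  : ∃ λ u → u ∈Γ[ G ] v × u ∉ A₂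
    cover    : ∀ u → u ∈Γ[ G ] v → u ∈ A₁ ⊎ u ∈ A₂

-- Vertex set Fin (2 + n):
--   zero        = v₁,
--   suc zero    = v₂,
--   suc (suc i) = old vertex i, where the old vertex v now plays v₀
--                 (it loses all its old edges and is joined to v₁, v₂ only).
isV : ∀ {n} → Fin n → Fin n → Bool
isV v i = ⌊ i ≟ v ⌋

sAdj : ∀ {n} → Graph n → Fin n → Subset n → Subset n →
       Fin (suc (suc n)) → Fin (suc (suc n)) → Bool
sAdj G v A₁ A₂ zero zero = false
sAdj G v A₁ A₂ zero (suc zero) = false
sAdj G v A₁ A₂ zero (suc (suc j)) = isV v j ∨ lookup A₁ j
sAdj G v A₁ A₂ (suc zero) zero = false
sAdj G v A₁ A₂ (suc zero) (suc zero) = false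
sAdj G v A₁ A₂ (suc zero) (suc (suc j)) = isV v j ∨ lookup A₂ j
sAdj G v A₁ A₂ (suc (suc i)) zero = isV v i ∨ lookup A₁ i
sAdj G v A₁ A₂ (suc (suc i)) (suc zero) = isV v i ∨ lookup A₂ i
sAdj G v A₁ A₂ (suc (suc i)) (suc (suc j)) =
  if isV v i ∨ isV v j then false else adj G i j

sAdj-sym : ∀ {n} (G : Graph n) v A₁ A₂ i j →
           sAdj G v A₁ A₂ i j ≡ sAdj G v A₁ A₂ j i
sAdj-sym G v A₁ A₂ zero zero = refl
sAdj-sym G v A₁ A₂ zero (suc zero) = refl
sAdj-sym G v A₁ A₂ zero (suc (suc j)) = refl
sAdj-sym G v A₁ A₂ (suc zero) zero = refl
sAdj-sym G v A₁ A₂ (suc zero) (suc zero) = refl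
sAdj-sym G v A₁ A₂ (suc zero) (suc (suc j)) = refl
sAdj-sym G v A₁ A₂ (suc (suc i)) zero = refl
sAdj-sym G v A₁ A₂ (suc (suc i)) (suc zero) = refl
sAdj-sym G v A₁ A₂ (suc (suc i)) (suc (suc j)) =
  cong₂ (λ b c → if b then false else c) (∨-comm (isV v i) (isV v j)) (sym G i j)

sAdj-irref : ∀ {n} (G : Graph n) v A₁ A₂ i → sAdj G v A₁ A₂ i i ≡ false
sAdj-irref G v A₁ A₂ zero = refl
sAdj-irref G v A₁ A₂ (suc zero) = refl
sAdj-irref G v A₁ A₂ (suc (suc i)) with isV v i
... | true = refl
... | false = irref G i

stretch : ∀ {n} → Graph n → Fin n → Subset n → Subset n → Graph (suc (suc n))
stretch G v A₁ A₂ = record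
  { adj = sAdj G v A₁ A₂
  ; sym = sAdj-sym G v A₁ A₂
  ; irref = sAdj-irref G v A₁ A₂ }

data S₂^ {n} (G : Graph n) : (k : ℕ) → {m : ℕ} → Graph m → Set where
  base : S₂^ G zero G
  step : ∀ {k m} {H : Graph m} → S₂^ G k H →
         (v : Fin m) (A₁ A₂ : Subset m) → StretchData H v A₁ A₂ →
         S₂^ G (suc k) (stretch H v A₁ A₂)

{-# OPTIONS --safe #-}
module Submission where

-- A 2-stretching raises α by exactly one, and induction on k does the rest.
-- A stable set S of G grows by one vertex: if v ∈ S, trade v for v₁ and v₂,
-- whose neighbours lie in Γ(v) and so miss S; otherwise add v₀.  A stable set T
-- of the stretched graph shrinks by at most one: containing both v₁ and v₂, it
-- misses v₀ and, as A₁ ∪ A₂ = Γ(v), all of Γ(v), so trading them for v is stable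
-- in G; containing one of them, it misses v₀; containing neither, drop v₀.

open import Defs hiding (sym)
open import Data.Nat using (ℕ; zero; suc; _+_; _≤_; s≤s)
open import Data.Nat.Properties using (+-identityʳ; +-suc; ≤-refl; ≤-reflexive; ≤-trans; n≤1+n)
open import Data.Bool using (true; false; _∨_)
open import Data.Bool.Properties using (¬-not; ∨-zeroʳ)
open import Data.Fin using (Fin; zero; suc; _≟_)
open import Data.Fin.Subset using (Subset; inside; outside; _∈_; _∉_; _⊆_; _∪_; _-_; ⁅_⁆; ∣_∣)
open import Data.Fin.Subset.Properties
  using (_∈?_; x∈p∪q⁻; x∈⁅y⁆⇒x≡y; p─q⊆p; p─⊥≡p; ∪-identityˡ)
open import Data.Vec using (_∷_; here; there; lookup)
open import Data.Vec.Properties using ([]=⇒lookup; lookup⇒[]=)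
open import Data.Product using (Σ; _×_; _,_)
open import Data.Sum using (_⊎_; inj₁; inj₂; [_,_]′)
open import Function using (_∘_; id; case_of_)
open import Relation.Nullary using (yes; no)
open import Relation.Nullary.Decidable using (isYes≗does; dec-true; dec-false)
open import Relation.Binary.PropositionalEquality
  using (_≡_; _≢_; refl; sym; trans; cong; subst)

x∉p-x : ∀ {n} (p : Subset n) x → x ∉ p - x
x∉p-x (_ ∷ p) (suc x) (there x∈) = x∉p-x p x x∈

x∈p⇒∣p∣≡1+∣p-x∣ : ∀ {n} {p : Subset n} {x} → x ∈ p → ∣ p ∣ ≡ suc ∣ p - x ∣
x∈p⇒∣p∣≡1+∣p-x∣ {p = inside ∷ p} here = cong (suc ∘ ∣_∣) (sym (p─⊥≡p p))
x∈p⇒∣p∣≡1+∣p-x∣ {p = inside ∷ p} (there x∈) = cong suc (x∈p⇒∣p∣≡1+∣p-x∣ x∈)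
x∈p⇒∣p∣≡1+∣p-x∣ {p = outside ∷ p} (there x∈) = x∈p⇒∣p∣≡1+∣p-x∣ x∈

x∉p⇒∣⁅x⁆∪p∣≡1+∣p∣ : ∀ {n} {p : Subset n} {x} → x ∉ p → ∣ ⁅ x ⁆ ∪ p ∣ ≡ suc ∣ p ∣
x∉p⇒∣⁅x⁆∪p∣≡1+∣p∣ {p = inside ∷ p} {zero} x∉ = case x∉ here of λ ()
x∉p⇒∣⁅x⁆∪p∣≡1+∣p∣ {p = outside ∷ p} {zero} x∉ = cong (suc ∘ ∣_∣) (∪-identityˡ p)
x∉p⇒∣⁅x⁆∪p∣≡1+∣p∣ {p = inside ∷ p} {suc x} x∉ = cong suc (x∉p⇒∣⁅x⁆∪p∣≡1+∣p∣ (x∉ ∘ there))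
x∉p⇒∣⁅x⁆∪p∣≡1+∣p∣ {p = outside ∷ p} {suc x} x∉ = x∉p⇒∣⁅x⁆∪p∣≡1+∣p∣ (x∉ ∘ there)

x∈p∧y∉p⇒x≢y : ∀ {n} {p : Subset n} {x y} → x ∈ p → y ∉ p → x ≢ y
x∈p∧y∉p⇒x≢y x∈ y∉ refl = y∉ x∈

module _ {n} (G : Graph n) where

  Stable⇒¬adj : ∀ {S i j} → Stable G S → i ∈ S → j ∈ S → adj G i j ≢ true
  Stable⇒¬adj st i∈ j∈ e = case trans (sym e) (st _ _ i∈ j∈) of λ ()

  Stable-⊆ : ∀ {S T} → S ⊆ T → Stable G T → Stable G S
  Stable-⊆ S⊆T st i j i∈ j∈ = st i j (S⊆T i∈) (S⊆T j∈)

  Stable-⁅x⁆∪ : ∀ {S x} → Stable G S → (∀ j → j ∈ S → adj G x j ≡ false) →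
                Stable G (⁅ x ⁆ ∪ S)
  Stable-⁅x⁆∪ {S} {x} st x≁S i j i∈ j∈ with x∈p∪q⁻ ⁅ x ⁆ S i∈ | x∈p∪q⁻ ⁅ x ⁆ S j∈
  ... | inj₁ i∈x | inj₁ j∈x rewrite x∈⁅y⁆⇒x≡y x i∈x | x∈⁅y⁆⇒x≡y x j∈x = irref G x
  ... | inj₁ i∈x | inj₂ j∈S rewrite x∈⁅y⁆⇒x≡y x i∈x = x≁S j j∈S
  ... | inj₂ i∈S | inj₁ j∈x rewrite x∈⁅y⁆⇒x≡y x j∈x = trans (Graph.sym G i x) (x≁S i i∈S)
  ... | inj₂ i∈S | inj₂ j∈S = st i j i∈S j∈S

IsAlpha-suc : ∀ {n m} {G : Graph n} {H : Graph m} {a} →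
  (∀ S → Stable G S → Σ (Subset m) λ T → Stable H T × ∣ T ∣ ≡ suc ∣ S ∣) →
  (∀ T → Stable H T → Σ (Subset n) λ S → Stable G S × ∣ T ∣ ≤ suc ∣ S ∣) →
  IsAlpha G a → IsAlpha H (suc a)
IsAlpha-suc {H = H} grow shrink ((S , stS , refl) , maximal) = grow S stS , bound
  where
  bound : ∀ T → Stable H T → ∣ T ∣ ≤ suc ∣ S ∣
  bound T stT with shrink T stT
  ... | S′ , stS′ , ∣T∣≤ = ≤-trans ∣T∣≤ (s≤s (maximal S′ stS′))

isV-self : ∀ {n} (v : Fin n) → isV v v ≡ true
isV-self v = trans (isYes≗does (v ≟ v)) (dec-true (v ≟ v) refl)

isV-≢ : ∀ {n} {v j : Fin n} → j ≢ v → isV v j ≡ false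
isV-≢ {v = v} {j} j≢v = trans (isYes≗does (j ≟ v)) (dec-false (j ≟ v) j≢v)

pattern v₁ = zero
pattern v₂ = suc zero
pattern old i = suc (suc i)
-- v₀ is old v.

module Stretching {n} (G : Graph n) (v : Fin n) (A₁ A₂ : Subset n) where

  H : Graph (suc (suc n))
  H = stretch G v A₁ A₂

  old-adj : ∀ {i j} → i ≢ v → j ≢ v → adj H (old i) (old j) ≡ adj G i j
  old-adj i≢v j≢v rewrite isV-≢ i≢v | isV-≢ j≢v = refl

  v₀-adj : ∀ {j} → adj H (old v) (old j) ≡ false
  v₀-adj rewrite isV-self v = refl

  -- isV v j ∨ lookup Aₗ j is how adj H vₗ (old j) unfolds.
  branch-v₀ : ∀ {A} → isV v v ∨ lookup A v ≡ true
  branch-v₀ rewrite isV-self v = refl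

  branch-adj : ∀ {A j} → j ∈ A → isV v j ∨ lookup A j ≡ true
  branch-adj {A} {j} j∈A rewrite []=⇒lookup j∈A = ∨-zeroʳ (isV v j)

  branch-nonadj : ∀ {A j} → j ≢ v → j ∉ A → isV v j ∨ lookup A j ≡ false
  branch-nonadj {A} {j} j≢v j∉A rewrite isV-≢ j≢v = ¬-not (j∉A ∘ lookup⇒[]= j A)

  Stable-lift : ∀ {S} → Stable G S → v ∉ S → Stable H (outside ∷ outside ∷ S)
  Stable-lift st v∉S _ _ (there (there i∈)) (there (there j∈)) =
    trans (old-adj (x∈p∧y∉p⇒x≢y i∈ v∉S) (x∈p∧y∉p⇒x≢y j∈ v∉S)) (st _ _ i∈ j∈)

  Stable-restrict : ∀ {t₁ t₂ T S} → Stable H (t₁ ∷ t₂ ∷ T) → S ⊆ T → v ∉ S → Stable G S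
  Stable-restrict st S⊆T v∉S i j i∈ j∈ =
    trans (sym (old-adj (x∈p∧y∉p⇒x≢y i∈ v∉S) (x∈p∧y∉p⇒x≢y j∈ v∉S)))
          (st (old i) (old j) (there (there (S⊆T i∈))) (there (there (S⊆T j∈))))

  v₁∈⇒v∉ : ∀ {t₂ T} → Stable H (inside ∷ t₂ ∷ T) → v ∉ T
  v₁∈⇒v∉ st v∈ = Stable⇒¬adj H st here (there (there v∈)) (branch-v₀ {A₁})

  v₂∈⇒v∉ : ∀ {t₁ T} → Stable H (t₁ ∷ inside ∷ T) → v ∉ T
  v₂∈⇒v∉ st v∈ = Stable⇒¬adj H st (there here) (there (there v∈)) (branch-v₀ {A₂})

  module _ (sub₁ : ∀ u → u ∈ A₁ → u ∈Γ[ G ] v) (sub₂ : ∀ u → u ∈ A₂ → u ∈Γ[ G ] v)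
           (cover : ∀ u → u ∈Γ[ G ] v → u ∈ A₁ ⊎ u ∈ A₂) where

    grow : ∀ S → Stable G S → Σ (Subset (suc (suc n))) λ T → Stable H T × ∣ T ∣ ≡ suc ∣ S ∣
    grow S st with v ∈? S
    ... | no v∉S =
      ⁅ old v ⁆ ∪ (outside ∷ outside ∷ S) ,
      Stable-⁅x⁆∪ H {x = old v} (Stable-lift st v∉S) (λ { _ (there (there _)) → v₀-adj }) ,
      x∉p⇒∣⁅x⁆∪p∣≡1+∣p∣ {p = outside ∷ outside ∷ S} {old v} λ { (there (there v∈S)) → v∉S v∈S }
    ... | yes v∈S = inside ∷ inside ∷ (S - v) , stable , cong suc (sym (x∈p⇒∣p∣≡1+∣p-x∣ v∈S))
      where
      branch-avoids : ∀ {A j} → (∀ u → u ∈ A → u ∈Γ[ G ] v) → j ∈ S - v → isV v j ∨ lookup A j ≡ false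
      branch-avoids {j = j} sub j∈ = branch-nonadj (x∈p∧y∉p⇒x≢y j∈ (x∉p-x S v))
        (Stable⇒¬adj G st v∈S (p─q⊆p S ⁅ v ⁆ j∈) ∘ sub j)

      stable : Stable H (inside ∷ inside ∷ (S - v))
      stable v₁ v₁ _ _ = refl
      stable v₁ v₂ _ _ = refl
      stable v₂ v₁ _ _ = refl
      stable v₂ v₂ _ _ = refl
      stable v₁ (old j) _ (there (there j∈)) = branch-avoids sub₁ j∈
      stable v₂ (old j) _ (there (there j∈)) = branch-avoids sub₂ j∈
      stable (old i) v₁ (there (there i∈)) _ = branch-avoids sub₁ i∈
      stable (old i) v₂ (there (there i∈)) _ = branch-avoids sub₂ i∈
      stable (old i) (old j) (there (there i∈)) (there (there j∈)) =
        Stable-lift (Stable-⊆ G (p─q⊆p S ⁅ v ⁆) st) (x∉p-x S v)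
          (old i) (old j) (there (there i∈)) (there (there j∈))

    shrink : ∀ T → Stable H T → Σ (Subset n) λ S → Stable G S × ∣ T ∣ ≤ suc ∣ S ∣
    shrink (inside ∷ inside ∷ T) st =
      ⁅ v ⁆ ∪ T ,
      Stable-⁅x⁆∪ G (Stable-restrict st id v∉T) v≁T ,
      ≤-reflexive (cong suc (sym (x∉p⇒∣⁅x⁆∪p∣≡1+∣p∣ v∉T)))
      where
      v∉T : v ∉ T
      v∉T = v₁∈⇒v∉ st

      v≁T : ∀ j → j ∈ T → adj G v j ≡ false
      v≁T j j∈ = ¬-not λ v~j → [ Stable⇒¬adj H st here (there (there j∈)) ∘ branch-adj
                               , Stable⇒¬adj H st (there here) (there (there j∈)) ∘ branch-adj
                               ]′ (cover j v~j)
    shrink (inside ∷ outside ∷ T) st = T , Stable-restrict st id (v₁∈⇒v∉ st) , ≤-refl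
    shrink (outside ∷ inside ∷ T) st = T , Stable-restrict st id (v₂∈⇒v∉ st) , ≤-refl
    shrink (outside ∷ outside ∷ T) st with v ∈? T
    ... | no v∉T = T , Stable-restrict st id v∉T , n≤1+n ∣ T ∣
    ... | yes v∈T =
      T - v , Stable-restrict st (p─q⊆p T ⁅ v ⁆) (x∉p-x T v) , ≤-reflexive (x∈p⇒∣p∣≡1+∣p-x∣ v∈T)

    IsAlpha-stretch : ∀ {a} → IsAlpha G a → IsAlpha H (suc a)
    IsAlpha-stretch = IsAlpha-suc {G = G} {H = H} grow shrink

lemma17 : ∀ {n m} (G : Graph n) (k : ℕ) (H : Graph m) → S₂^ G k H →
          ∀ (a : ℕ) → IsAlpha G a → IsAlpha H (a + k)
lemma17 G zero G base a α = subst (IsAlpha G) (sym (+-identityʳ a)) α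
lemma17 G (suc k) _ (step {H = H} H∈S₂^k v A₁ A₂ D) a α =
  subst (IsAlpha (stretch H v A₁ A₂)) (sym (+-suc a k))
    (Stretching.IsAlpha-stretch H v A₁ A₂ sub₁ sub₂ cover (lemma17 G k H H∈S₂^k a α))
  where open StretchData D
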